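{- Let $G$ be a singular simple graph whose set $CV$ of core vertices is independent. Let $u\in CV$ and $w\in N(CV)$ with $u\not\sim w$, and let $G'=G+\{u,w\}$ be obtained by adding the edge $\{u,w\}$, where it is assumed that the core-labelling is preserved, i.e. $G'$ has the same sets $CV$, $N(CV)$ and $CFV_R$ as $G$ (with $CV$ independent in $G'$). Let $\mathbf{Q}$ and $\mathbf{Q}'$ be the submatrices of the adjacency matrices of $G$ and $G'$ respectively, with rows indexed by $CV$ and columns indexed by $N(CV)$. Then $\eta(G')\ge\eta(G)$. Moreover, there is a vector $\mathbf{x}_{CV}\in\ker(\mathbf{Q}^\intercal)\setminus\ker((\mathbf{Q}')^\intercal)$ and a vector $\mathbf{y}_{CV}\in\ker((\mathbf{Q}')^\intercal)\setminus\ker(\mathbf{Q}^\intercal)$.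
   Context: $\eta(G)=\dim\ker\mathbf{A}$ for the $\{0,1\}$-adjacency matrix $\mathbf{A}$; $G$ is singular if $\eta(G)>0$. A vertex $v$ is a core vertex if some $\mathbf{x}\in\ker\mathbf{A}$ has $x_v\neq0$; $CV$ is the set of core vertices. $N(CV)$ is the set of vertices adjacent to at least one core vertex and $CFV_R=V\setminus(CV\cup N(CV))$.
   Formalization: All kernel vectors, in the definitions of η, core vertices and $\ker(\mathbf{Q}^\intercal)$ as well as the vectors $\mathbf{x}_{CV}$ and $\mathbf{y}_{CV}$, are taken over the rationals. -}

module Defs where

open import Data.Nat using (ℕ; zero; suc)
open import Data.Fin using (Fin; zero; suc)
open import Data.Fin.Properties using (_≟_)
open import Data.Bool using (Bool; true; false; _∨_; _∧_; T)
open import Data.Rational using (ℚ; 0ℚ; 1ℚ; _+_; _*_)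
open import Data.Product using (Σ; ∃; _×_; _,_)
open import Relation.Binary.PropositionalEquality using (_≡_)
open import Relation.Nullary using (¬_; Dec; does)
open import Function.Bundles using (_⇔_)

record Graph (n : ℕ) : Set where
  field
    adj     : Fin n → Fin n → Bool
    sym     : ∀ i j → adj i j ≡ adj j i
    irrefl  : ∀ i → adj i i ≡ false
open Graph public

_∼[_]_ : ∀ {n} → Fin n → Graph n → Fin n → Set
i ∼[ G ] j = T (adj G i j)

∑ : ∀ {n} → (Fin n → ℚ) → ℚ
∑ {zero}  f = 0ℚ
∑ {suc n} f = f zero + ∑ (λ i → f (suc i))

𝐀 : ∀ {n} → Graph n → Fin n → Fin n → ℚ
𝐀 G i j with adj G i j
... | true  = 1ℚ
... | false = 0ℚ

InKer : ∀ {n} → Graph n → (Fin n → ℚ) → Set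
InKer {n} G x = ∀ i → ∑ (λ j → 𝐀 G i j * x j) ≡ 0ℚ

LinIndep : ∀ {n k} → (Fin k → Fin n → ℚ) → Set
LinIndep {n} {k} v =
  ∀ (c : Fin k → ℚ) → (∀ j → ∑ (λ i → c i * v i j) ≡ 0ℚ) → ∀ i → c i ≡ 0ℚ

NullityAtLeast : ∀ {n} → Graph n → ℕ → Set
NullityAtLeast {n} G k =
  Σ (Fin k → Fin n → ℚ) λ v → LinIndep v × (∀ i → InKer G (v i))

NullityLe : ∀ {n} → Graph n → Graph n → Set
NullityLe G G' = ∀ k → NullityAtLeast G k → NullityAtLeast G' k

Singular : ∀ {n} → Graph n → Set
Singular G = NullityAtLeast G 1

IsCore : ∀ {n} → Graph n → Fin n → Set
IsCore G v = Σ _ λ x → InKer G x × ¬ (x v ≡ 0ℚ)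

InNCV : ∀ {n} → Graph n → Fin n → Set
InNCV G v = ∃ λ u → IsCore G u × u ∼[ G ] v

InCFVR : ∀ {n} → Graph n → Fin n → Set
InCFVR G v = ¬ IsCore G v × ¬ InNCV G v

CoreIndependent : ∀ {n} → Graph n → Set
CoreIndependent G = ∀ u v → IsCore G u → IsCore G v → ¬ (u ∼[ G ] v)

private
  eqb : ∀ {n} → Fin n → Fin n → Bool
  eqb i j = does (i ≟ j)

addAdj : ∀ {n} → Graph n → Fin n → Fin n → Fin n → Fin n → Bool
addAdj G u w i j = adj G i j ∨ ((eqb i u ∧ eqb j w) ∨ (eqb i w ∧ eqb j u))

IsAddEdge : ∀ {n} → Graph n → Fin n → Fin n → Graph n → Set
IsAddEdge G u w G' = ∀ i j → adj G' i j ≡ addAdj G u w i j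

-- Vectors indexed by CV, represented as vectors on V vanishing off CV
SupportedOnCore : ∀ {n} → Graph n → (Fin n → ℚ) → Set
SupportedOnCore G x = ∀ v → ¬ IsCore G v → x v ≡ 0ℚ

-- x_CV ∈ ker(Qᵀ), Q = A[CV, N(CV)] : for every column j ∈ N(CV),
-- ∑_{i ∈ CV} A i j x_i = 0   (x vanishes off CV, so sum over all i)
InKerQT : ∀ {n} → Graph n → (Fin n → ℚ) → Set
InKerQT G x = ∀ j → InNCV G j → ∑ (λ i → 𝐀 G i j * x i) ≡ 0ℚ

module Submission where

-- The column of w in Q' is that of Q plus the unit vector at u, so a vector
-- in ker Qᵀ and one in ker Q'ᵀ cannot both be nonzero at u; a kernel vector
-- x of G and a kernel vector y of G' that are nonzero at u, which exist since
-- u is a core vertex of both graphs, therefore separate the two kernels.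
-- For the nullity, z ↦ x_u z − z_u x maps ker A(G) into the vectors of
-- ker A(G) vanishing at u and, w not being a core vertex, at w; these lie in
-- ker A(G') as only the entries (u,w), (w,u) change.  Adding (x_u z_u) y gives
-- the map z ↦ y_u x_u z + z_u (x_u y − y_u x) from ker A(G) into ker A(G'),
-- which is injective because the u-th entry of x_u y − y_u x is zero.

open import Defs hiding (sym)
open import Data.Nat using (ℕ; zero; suc)
open import Data.Fin using (Fin; zero; suc)
open import Data.Fin.Properties using (_≟_; suc-injective)
open import Data.Rational using (ℚ; 0ℚ; 1ℚ; _+_; _*_; -_; _-_; 1/_; ≢-nonZero)
import Data.Rational.Properties as ℚ
open import Data.Rational.Solver using (module +-*-Solver)
open import Data.Product using (Σ; _×_; _,_)
open import Data.Bool using (true; false)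
open import Data.Bool.Properties using (∨-zeroʳ; ∨-identityʳ)
open import Data.Empty using (⊥-elim)
open import Relation.Binary.PropositionalEquality
  using (_≡_; _≢_; refl; sym; trans; cong; cong₂; module ≡-Reasoning)
open import Relation.Nullary using (¬_; yes; no)
open import Function.Base using (_∘_)
open import Function.Bundles using (_⇔_; Equivalence)
open +-*-Solver

private
  variable
    n : ℕ

∑-cong : {f g : Fin n → ℚ} → (∀ i → f i ≡ g i) → ∑ f ≡ ∑ g
∑-cong {zero}  f≗g = refl
∑-cong {suc n} f≗g = cong₂ _+_ (f≗g zero) (∑-cong (λ i → f≗g (suc i)))

∑-+ : (f g : Fin n → ℚ) → ∑ (λ i → f i + g i) ≡ ∑ f + ∑ g
∑-+ {zero}  f g = refl
∑-+ {suc n} f g =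
  trans (cong (f zero + g zero +_) (∑-+ (λ i → f (suc i)) (λ i → g (suc i))))
        (solve 4 (λ a b c d → (a :+ b) :+ (c :+ d) := (a :+ c) :+ (b :+ d)) refl
               (f zero) (g zero) _ _)

∑-* : (k : ℚ) (f : Fin n → ℚ) → ∑ (λ i → k * f i) ≡ k * ∑ f
∑-* {zero}  k f = sym (ℚ.*-zeroʳ k)
∑-* {suc n} k f = trans (cong (k * f zero +_) (∑-* k (λ i → f (suc i))))
                        (sym (ℚ.*-distribˡ-+ k (f zero) _))

∑-update : (f g : Fin n → ℚ) (u : Fin n) (d : ℚ) →
           (∀ i → i ≢ u → f i ≡ g i) → f u ≡ g u + d → ∑ f ≡ ∑ g + d
∑-update {suc n} f g zero d f≗g fu =
  trans (cong₂ _+_ fu (∑-cong (λ i → f≗g (suc i) (λ ()))))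
        (solve 3 (λ a b c → (a :+ c) :+ b := (a :+ b) :+ c) refl (g zero) _ d)
∑-update {suc n} f g (suc u) d f≗g fu =
  trans (cong₂ _+_ (f≗g zero (λ ()))
                   (∑-update (λ i → f (suc i)) (λ i → g (suc i)) u d
                             (λ i i≢u → f≗g (suc i) (λ e → i≢u (suc-injective e))) fu))
        (sym (ℚ.+-assoc (g zero) _ d))

p≢0⇒p*q≡0⇒q≡0 : {p q : ℚ} → p ≢ 0ℚ → p * q ≡ 0ℚ → q ≡ 0ℚ
p≢0⇒p*q≡0⇒q≡0 {p} {q} p≢0 pq≡0 = begin
  q               ≡⟨ sym (ℚ.*-identityˡ q) ⟩
  1ℚ * q          ≡⟨ cong (_* q) (sym (ℚ.*-inverseˡ p)) ⟩
  (1/ p * p) * q  ≡⟨ ℚ.*-assoc (1/ p) p q ⟩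
  1/ p * (p * q)  ≡⟨ cong (1/ p *_) pq≡0 ⟩
  1/ p * 0ℚ       ≡⟨ ℚ.*-zeroʳ (1/ p) ⟩
  0ℚ              ∎
  where
    open ≡-Reasoning
    instance _ = ≢-nonZero p≢0

𝐀-cong : (G H : Graph n) {i j k l : Fin n} → adj G i j ≡ adj H k l → 𝐀 G i j ≡ 𝐀 H k l
𝐀-cong G H {i} {j} {k} {l} e with adj G i j | adj H k l
... | true  | true  = refl
... | false | false = refl

𝐀-sym : (G : Graph n) (i j : Fin n) → 𝐀 G i j ≡ 𝐀 G j i
𝐀-sym G i j = 𝐀-cong G G (Graph.sym G i j)

𝐀-adjacent : (G : Graph n) {i j : Fin n} → adj G i j ≡ true → 𝐀 G i j ≡ 1ℚ
𝐀-adjacent G {i} {j} e with adj G i j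
... | true = refl

𝐀-nonadjacent : (G : Graph n) {i j : Fin n} → ¬ i ∼[ G ] j → 𝐀 G i j ≡ 0ℚ
𝐀-nonadjacent G {i} {j} i≁j with adj G i j
... | true  = ⊥-elim (i≁j _)
... | false = refl

addAdj-edge : (G : Graph n) (u w : Fin n) → addAdj G u w u w ≡ true
addAdj-edge G u w with u ≟ u | w ≟ w
... | yes _  | yes _  = ∨-zeroʳ _
... | no u≢u | _      = ⊥-elim (u≢u refl)
... | _      | no w≢w = ⊥-elim (w≢w refl)

addAdj-other : (G : Graph n) {u w i j : Fin n} →
               ¬ (i ≡ u × j ≡ w) → ¬ (i ≡ w × j ≡ u) → addAdj G u w i j ≡ adj G i j
addAdj-other G {u} {w} {i} {j} ≢uw ≢wu with i ≟ u | j ≟ w | i ≟ w | j ≟ u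
... | yes i≡u | yes j≡w | _       | _       = ⊥-elim (≢uw (i≡u , j≡w))
... | _       | _       | yes i≡w | yes j≡u = ⊥-elim (≢wu (i≡w , j≡u))
... | no _    | _       | no _    | _       = ∨-identityʳ _
... | no _    | _       | yes _   | no _    = ∨-identityʳ _
... | yes _   | no _    | no _    | _       = ∨-identityʳ _
... | yes _   | no _    | yes _   | no _    = ∨-identityʳ _

InKer-cong : (H : Graph n) {a b : Fin n → ℚ} → (∀ j → a j ≡ b j) → InKer H a → InKer H b
InKer-cong H a≗b a∈ker i = trans (∑-cong (λ j → cong (𝐀 H i j *_) (sym (a≗b j)))) (a∈ker i)

InKer-lincomb : (H : Graph n) (p q : ℚ) {a b : Fin n → ℚ} →
                InKer H a → InKer H b → InKer H (λ j → p * a j + q * b j)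
InKer-lincomb H p q {a} {b} a∈ker b∈ker i = begin
  ∑ (λ j → 𝐀 H i j * (p * a j + q * b j))
    ≡⟨ ∑-cong (λ j → solve 5 (λ m p q x y → m :* (p :* x :+ q :* y)
                                          := p :* (m :* x) :+ q :* (m :* y))
                             refl (𝐀 H i j) p q (a j) (b j)) ⟩
  ∑ (λ j → p * (𝐀 H i j * a j) + q * (𝐀 H i j * b j))
    ≡⟨ ∑-+ (λ j → p * (𝐀 H i j * a j)) (λ j → q * (𝐀 H i j * b j)) ⟩
  ∑ (λ j → p * (𝐀 H i j * a j)) + ∑ (λ j → q * (𝐀 H i j * b j))
    ≡⟨ cong₂ _+_ (∑-* p (λ j → 𝐀 H i j * a j)) (∑-* q (λ j → 𝐀 H i j * b j)) ⟩
  p * ∑ (λ j → 𝐀 H i j * a j) + q * ∑ (λ j → 𝐀 H i j * b j)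
    ≡⟨ cong₂ (λ s t → p * s + q * t) (a∈ker i) (b∈ker i) ⟩
  p * 0ℚ + q * 0ℚ
    ≡⟨ solve 2 (λ p q → p :* con 0ℚ :+ q :* con 0ℚ := con 0ℚ) refl p q ⟩
  0ℚ ∎
  where open ≡-Reasoning

InKer⇒SupportedOnCore : (H : Graph n) {z : Fin n → ℚ} → InKer H z → SupportedOnCore H z
InKer⇒SupportedOnCore H {z} z∈ker v v∉CV with z v ℚ.≟ 0ℚ
... | yes zv≡0 = zv≡0
... | no  zv≢0 = ⊥-elim (v∉CV (z , z∈ker , zv≢0))

InKer⇒InKerQT : (H : Graph n) {z : Fin n → ℚ} → InKer H z → InKerQT H z
InKer⇒InKerQT H {z} z∈ker j _ = trans (∑-cong (λ i → cong (_* z i) (𝐀-sym H i j))) (z∈ker j)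

NullityLe-by-injection :
  (G G' : Graph n) (φ : (Fin n → ℚ) → Fin n → ℚ) →
  (∀ {k} (c : Fin k → ℚ) (v : Fin k → Fin n → ℚ) j →
     ∑ (λ i → c i * φ (v i) j) ≡ φ (λ j → ∑ (λ i → c i * v i j)) j) →
  (∀ z → (∀ j → φ z j ≡ 0ℚ) → ∀ j → z j ≡ 0ℚ) →
  (∀ z → InKer G z → InKer G' (φ z)) →
  NullityLe G G'
NullityLe-by-injection G G' φ linear injective φ-ker k (v , v-indep , v∈ker) =
  (λ i → φ (v i)) , φv-indep , (λ i → φ-ker (v i) (v∈ker i))
  where
    φv-indep : LinIndep (λ i → φ (v i))
    φv-indep c ∑cφv≡0 =
      v-indep c (injective _ (λ j → trans (sym (linear c v j)) (∑cφv≡0 j)))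

rankOneUpdate : ℚ → (Fin n → ℚ) → Fin n → (Fin n → ℚ) → Fin n → ℚ
rankOneUpdate a b u z j = a * z j + b j * z u

∑-rankOneUpdate : (a : ℚ) (b : Fin n → ℚ) (u : Fin n) {k : ℕ}
                  (c : Fin k → ℚ) (v : Fin k → Fin n → ℚ) (j : Fin n) →
                  ∑ (λ i → c i * rankOneUpdate a b u (v i) j)
                    ≡ rankOneUpdate a b u (λ j → ∑ (λ i → c i * v i j)) j
∑-rankOneUpdate a b u c v j = begin
  ∑ (λ i → c i * (a * v i j + b j * v i u))
    ≡⟨ ∑-cong (λ i → solve 5 (λ c a b x y → c :* (a :* x :+ b :* y)
                                          := a :* (c :* x) :+ b :* (c :* y))
                             refl (c i) a (b j) (v i j) (v i u)) ⟩
  ∑ (λ i → a * (c i * v i j) + b j * (c i * v i u))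
    ≡⟨ ∑-+ (λ i → a * (c i * v i j)) (λ i → b j * (c i * v i u)) ⟩
  ∑ (λ i → a * (c i * v i j)) + ∑ (λ i → b j * (c i * v i u))
    ≡⟨ cong₂ _+_ (∑-* a (λ i → c i * v i j)) (∑-* (b j) (λ i → c i * v i u)) ⟩
  a * ∑ (λ i → c i * v i j) + b j * ∑ (λ i → c i * v i u) ∎
  where open ≡-Reasoning

rankOneUpdate-injective : {a : ℚ} {b : Fin n → ℚ} {u : Fin n} → a ≢ 0ℚ → b u ≡ 0ℚ →
                          ∀ z → (∀ j → rankOneUpdate a b u z j ≡ 0ℚ) → ∀ j → z j ≡ 0ℚ
rankOneUpdate-injective {a = a} {b} {u} a≢0 bu≡0 z φz≡0 j =
  p≢0⇒p*q≡0⇒q≡0 a≢0 (without-update j (trans (cong (b j *_) zu≡0) (ℚ.*-zeroʳ (b j))))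
  where
    without-update : ∀ j → b j * z u ≡ 0ℚ → a * z j ≡ 0ℚ
    without-update j bj*zu≡0 = begin
      a * z j                   ≡⟨ sym (ℚ.+-identityʳ (a * z j)) ⟩
      a * z j + 0ℚ              ≡⟨ cong (a * z j +_) (sym bj*zu≡0) ⟩
      rankOneUpdate a b u z j   ≡⟨ φz≡0 j ⟩
      0ℚ                        ∎
      where open ≡-Reasoning
    zu≡0 : z u ≡ 0ℚ
    zu≡0 = p≢0⇒p*q≡0⇒q≡0 a≢0
             (without-update u (trans (cong (_* z u) bu≡0) (ℚ.*-zeroˡ (z u))))

module AddEdge (G G' : Graph n) {u w : Fin n}
               (G'≡G+uw : IsAddEdge G u w G') (u≁w : ¬ u ∼[ G ] w) where

  𝐀-other : {i j : Fin n} → ¬ (i ≡ u × j ≡ w) → ¬ (i ≡ w × j ≡ u) → 𝐀 G' i j ≡ 𝐀 G i j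
  𝐀-other ≢uw ≢wu = 𝐀-cong G' G (trans (G'≡G+uw _ _) (addAdj-other G ≢uw ≢wu))

  column-w : (z : Fin n → ℚ) → ∑ (λ i → 𝐀 G' i w * z i) ≡ ∑ (λ i → 𝐀 G i w * z i) + z u
  column-w z = ∑-update _ _ u (z u) other edge
    where
      other : ∀ i → i ≢ u → 𝐀 G' i w * z i ≡ 𝐀 G i w * z i
      other i i≢u = cong (_* z i) (𝐀-other (λ (i≡u , _) → i≢u i≡u)
                                           (λ (i≡w , w≡u) → i≢u (trans i≡w w≡u)))
      edge : 𝐀 G' u w * z u ≡ 𝐀 G u w * z u + z u
      edge = begin
        𝐀 G' u w * z u   ≡⟨ cong (_* z u) (𝐀-adjacent G' (trans (G'≡G+uw u w) (addAdj-edge G u w))) ⟩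
        1ℚ * z u         ≡⟨ solve 1 (λ a → con 1ℚ :* a := con 0ℚ :* a :+ a) refl (z u) ⟩
        0ℚ * z u + z u   ≡⟨ cong (λ a → a * z u + z u) (sym (𝐀-nonadjacent G u≁w)) ⟩
        𝐀 G u w * z u + z u ∎
        where open ≡-Reasoning

  InKer-vanishing : {h : Fin n → ℚ} → InKer G h → h u ≡ 0ℚ → h w ≡ 0ℚ → InKer G' h
  InKer-vanishing {h} h∈ker hu≡0 hw≡0 i = trans (∑-cong term) (h∈ker i)
    where
      zero-entry : ∀ {j} → h j ≡ 0ℚ → 𝐀 G' i j * h j ≡ 𝐀 G i j * h j
      zero-entry {j} hj≡0 = begin
        𝐀 G' i j * h j  ≡⟨ cong (𝐀 G' i j *_) hj≡0 ⟩
        𝐀 G' i j * 0ℚ   ≡⟨ ℚ.*-zeroʳ (𝐀 G' i j) ⟩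
        0ℚ              ≡⟨ sym (ℚ.*-zeroʳ (𝐀 G i j)) ⟩
        𝐀 G i j * 0ℚ    ≡⟨ cong (𝐀 G i j *_) (sym hj≡0) ⟩
        𝐀 G i j * h j   ∎
        where open ≡-Reasoning
      term : ∀ j → 𝐀 G' i j * h j ≡ 𝐀 G i j * h j
      term j with j ≟ u | j ≟ w
      ... | yes refl | _        = zero-entry hu≡0
      ... | no _     | yes refl = zero-entry hw≡0
      ... | no j≢u   | no j≢w   =
        cong (_* h j) (𝐀-other (λ (_ , j≡w) → j≢w j≡w) (λ (_ , j≡u) → j≢u j≡u))

  InKerQT-both⇒≡0 : InNCV G w → InNCV G' w → {z : Fin n → ℚ} →
                    InKerQT G z → InKerQT G' z → z u ≡ 0ℚ
  InKerQT-both⇒≡0 w∈N w∈N' {z} z∈kerQ z∈kerQ' = begin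
    z u                              ≡⟨ sym (ℚ.+-identityˡ (z u)) ⟩
    0ℚ + z u                         ≡⟨ cong (_+ z u) (sym (z∈kerQ w w∈N)) ⟩
    ∑ (λ i → 𝐀 G i w * z i) + z u   ≡⟨ sym (column-w z) ⟩
    ∑ (λ i → 𝐀 G' i w * z i)        ≡⟨ z∈kerQ' w w∈N' ⟩
    0ℚ                               ∎
    where open ≡-Reasoning

  nullityLe : ¬ IsCore G w → {x y : Fin n → ℚ} → InKer G x → InKer G' y →
              x u ≢ 0ℚ → y u ≢ 0ℚ → NullityLe G G'
  nullityLe w∉CV {x} {y} x∈ker y∈ker xu≢0 yu≢0 =
    NullityLe-by-injection G G' φ (∑-rankOneUpdate (y u * x u) b u)
      (rankOneUpdate-injective {b = b} {u} yu*xu≢0 bu≡0) φ-ker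
    where
      b : Fin n → ℚ
      b j = x u * y j - y u * x j

      φ : (Fin n → ℚ) → Fin n → ℚ
      φ = rankOneUpdate (y u * x u) b u

      yu*xu≢0 : y u * x u ≢ 0ℚ
      yu*xu≢0 yu*xu≡0 = xu≢0 (p≢0⇒p*q≡0⇒q≡0 yu≢0 yu*xu≡0)

      bu≡0 : b u ≡ 0ℚ
      bu≡0 = solve 2 (λ a b → a :* b :- b :* a := con 0ℚ) refl (x u) (y u)

      φ-ker : ∀ z → InKer G z → InKer G' (φ z)
      φ-ker z z∈ker = InKer-cong G' regroup
                        (InKer-lincomb G' (y u) (x u * z u) h∈ker' y∈ker)
        where
          h : Fin n → ℚ
          h j = x u * z j + (- z u) * x j
          h∈ker : InKer G h
          h∈ker = InKer-lincomb G (x u) (- z u) z∈ker x∈ker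
          h∈ker' : InKer G' h
          h∈ker' = InKer-vanishing h∈ker
                     (solve 2 (λ a b → a :* b :+ (:- b) :* a := con 0ℚ) refl (x u) (z u))
                     (InKer⇒SupportedOnCore G h∈ker w w∉CV)
          regroup : ∀ j → y u * h j + (x u * z u) * y j ≡ φ z j
          regroup j = solve 6 (λ yu xu zj zu xj yj →
                                 yu :* (xu :* zj :+ (:- zu) :* xj) :+ (xu :* zu) :* yj
                                 := (yu :* xu) :* zj :+ (xu :* yj :- yu :* xj) :* zu)
                              refl (y u) (x u) (z j) (z u) (x j) (y j)

-- Singularity of G is implied by u being a core vertex.
mainTheorem18 : ∀ {n} (G G' : Graph n) (u w : Fin n)
    → Singular G
    → CoreIndependent G
    → IsCore G u
    → InNCV G w
    → ¬ (u ∼[ G ] w)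
    → IsAddEdge G u w G'
    → (∀ v → IsCore G v ⇔ IsCore G' v)
    → (∀ v → InNCV G v ⇔ InNCV G' v)
    → (∀ v → InCFVR G v ⇔ InCFVR G' v)
    → CoreIndependent G'
    → NullityLe G G'
      × Σ (Fin n → ℚ) (λ x → SupportedOnCore G x × InKerQT G x × ¬ InKerQT G' x)
      × Σ (Fin n → ℚ) (λ y → SupportedOnCore G y × InKerQT G' y × ¬ InKerQT G y)
mainTheorem18 G G' u w _ CV-indep u∈CV w∈N@(v , v∈CV , v∼w) u≁w G'≡G+uw CV⇔ N⇔ _ _
  with u∈CV | Equivalence.to (CV⇔ u) u∈CV
... | x , x∈ker , xu≢0 | y , y∈ker , yu≢0 =
  nullityLe w∉CV x∈ker y∈ker xu≢0 yu≢0 ,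
  (x , InKer⇒SupportedOnCore G x∈ker , x∈kerQ , λ x∈kerQ' → xu≢0 (separated x∈kerQ x∈kerQ')) ,
  (y , y-supported , y∈kerQ' , λ y∈kerQ → yu≢0 (separated y∈kerQ y∈kerQ'))
  where
    open AddEdge G G' G'≡G+uw u≁w
    w∉CV : ¬ IsCore G w
    w∉CV w∈CV = CV-indep v w v∈CV w∈CV v∼w
    separated : {z : Fin _ → ℚ} → InKerQT G z → InKerQT G' z → z u ≡ 0ℚ
    separated = InKerQT-both⇒≡0 w∈N (Equivalence.to (N⇔ w) w∈N)
    x∈kerQ : InKerQT G x
    x∈kerQ = InKer⇒InKerQT G x∈ker
    y∈kerQ' : InKerQT G' y
    y∈kerQ' = InKer⇒InKerQT G' y∈ker
    y-supported : SupportedOnCore G y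
    y-supported t t∉CV = InKer⇒SupportedOnCore G' y∈ker t (t∉CV ∘ Equivalence.from (CV⇔ t))
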